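{- Let $r>s\ge 2$ and $m\ge 1$ be integers, and let $G$ be a bipartite biregular graph with degrees $r$ and $s$ and odd diameter $d=2m+1$ whose order equals $$M(r,s;2m+1)=\left\lfloor\frac{N_2'}{\rho}\right\rfloor(\rho+\sigma),\qquad N_2'=1+s(r-1)\frac{[(r-1)(s-1)]^{m}-1}{(r-1)(s-1)-1},$$ where $\rho=r/\gcd\{r,s\}$ and $\sigma=s/\gcd\{r,s\}$. Then $G$ has girth $g\le 4m$.
   Context: A bipartite graph $G=(V_1\cup V_2,E)$ with stable sets $V_1,V_2$ is biregular with degrees $r$ and $s$ if every vertex of $V_1$ has degree $r$ and every vertex of $V_2$ has degree $s$. The quantity $M(r,s;2m+1)$ above is the Moore-like upper bound (due to Yebra, Fiol and Fàbrega) on the order of such a graph of diameter $2m+1$ when $r>s$. -}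

module Defs where

open import Data.Nat using (ℕ; zero; suc; _+_; _*_; _∸_; _^_; _≤_; _<_)
open import Data.Nat.DivMod using (_/_)
open import Data.Nat.GCD using (gcd)
open import Data.Bool using (Bool; true; false; T; not)
open import Data.Fin using (Fin; zero; suc; inject₁; fromℕ)
open import Data.Fin.Subset using (Subset; ∣_∣)
open import Data.Vec using (tabulate)
open import Data.Product using (Σ; ∃; _×_; _,_)
open import Relation.Binary.PropositionalEquality using (_≡_; _≢_)
open import Relation.Nullary using (¬_)
open import Function.Definitions using (Injective)

-- Floor division; the divisor is always positive where it is used below.
_div_ : ℕ → ℕ → ℕ
a div zero    = 0
a div (suc b) = a / suc b

N₂′ : ℕ → ℕ → ℕ → ℕ
N₂′ r s m = 1 + (s * (r ∸ 1)) * (((q ^ m) ∸ 1) div (q ∸ 1))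
  where q = (r ∸ 1) * (s ∸ 1)

ρ σ : ℕ → ℕ → ℕ
ρ r s = r div gcd r s
σ r s = s div gcd r s

M : ℕ → ℕ → ℕ → ℕ
M r s m = (N₂′ r s m div ρ r s) * (ρ r s + σ r s)

record Graph (n : ℕ) : Set where
  field
    adj   : Fin n → Fin n → Bool
    sym   : ∀ u v → adj u v ≡ adj v u
    irrefl : ∀ v → adj v v ≡ false
open Graph public

Adj : ∀ {n} → Graph n → Fin n → Fin n → Set
Adj G u v = T (adj G u v)

degree : ∀ {n} → Graph n → Fin n → ℕ
degree G u = ∣ tabulate (adj G u) ∣

-- part v = false : v ∈ V₁ ; part v = true : v ∈ V₂.  V₁, V₂ stable sets.
IsBipartition : ∀ {n} → Graph n → (Fin n → Bool) → Set
IsBipartition G part = ∀ u v → Adj G u v → part u ≢ part v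

Biregular : ∀ {n} → Graph n → (Fin n → Bool) → ℕ → ℕ → Set
Biregular G part r s =
  (∀ v → part v ≡ false → degree G v ≡ r) × (∀ v → part v ≡ true → degree G v ≡ s)

data Walk {n} (G : Graph n) : ℕ → Fin n → Fin n → Set where
  here : ∀ {v} → Walk G 0 v v
  step : ∀ {k u w v} → Adj G u w → Walk G k w v → Walk G (suc k) u v

DistLE : ∀ {n} → Graph n → ℕ → Fin n → Fin n → Set
DistLE G k u v = ∃ λ l → l ≤ k × Walk G l u v

HasDiameter : ∀ {n} → Graph n → ℕ → Set
HasDiameter G d = (∀ u v → DistLE G d u v) ×
  ∃ λ u → ∃ λ v → ∀ l → l < d → ¬ Walk G l u v

record Cycle {n} (G : Graph n) (j : ℕ) : Set where
  field
    vtx    : Fin (3 + j) → Fin n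
    inj    : Injective _≡_ _≡_ vtx
    consec : ∀ (i : Fin (2 + j)) → Adj G (vtx (inject₁ i)) (vtx (suc i))
    close  : Adj G (vtx (fromℕ (2 + j))) (vtx zero)

GirthLE : ∀ {n} → Graph n → ℕ → Set
GirthLE G g = ∃ λ j → 3 + j ≤ g × Cycle G j

-- Counting edges gives ∣V₁∣ r = ∣V₂∣ s, and together with ∣V₁∣ + ∣V₂∣ = M(r,s;2m+1) this forces
-- ∣V₂∣ = ⌊N₂′/ρ⌋ ρ, hence ∣V₁∣ r ≤ N₂′ s < N₁′ r, where N₁′ = 1 + r(s−1)(1 + q + ⋯ + q^(m−1)) and
-- q = (r−1)(s−1). But N₁′ is the number of non-backtracking walks of even length ≤ 2m from a vertex
-- v ∈ V₁, and they all end in V₁, so two distinct ones end at the same vertex. Cutting off their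
-- common initial segment and gluing the remainders gives a closed non-backtracking walk of length
-- ≤ 4m; its first repeated vertex closes a cycle of length ≤ 4m.

module Submission where

open import Defs
open import Data.Nat using (ℕ; zero; suc; pred; _+_; _*_; _∸_; _^_; _≤_; _<_; z≤n; s≤s; s≤s⁻¹; NonZero; >-nonZero)
open import Data.Nat.Properties
  using ( ≤-trans; ≤-reflexive; <-trans; <-≤-trans; n≤1+n; m≤m+n; m<m+n; 0<1+n; n>0⇒n≢0
        ; +-comm; +-identityʳ; +-mono-≤; *-comm; *-assoc; *-suc; *-zeroʳ; *-distribˡ-+; *-distribʳ-+
        ; *-mono-≤; *-monoˡ-≤; *-cancelʳ-≡; *-cancelʳ-<; m∸n≤m; m∸n+n≡m; m≤n⇒∃[o]m+o≡n
        ; +-*-semiring; +-0-commutativeMonoid; module ≤-Reasoning )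
open import Data.Nat.DivMod using (_/_; m*n/n≡m; m/n*n≤m)
open import Data.Nat.GCD using (gcd; gcd[m,n]∣m; gcd[m,n]∣n)
open import Data.Nat.Divisibility using (divides)
open import Data.Nat.Tactic.RingSolver using (solve-∀)
open import Data.Bool using (Bool; true; false; T; not)
open import Data.Bool.Properties using (not-involutive)
open import Data.Empty using (⊥-elim)
open import Data.Unit using (⊤)
open import Data.Fin using (Fin; zero; suc; inject₁; fromℕ)
open import Data.Fin.Properties using (_≟_)
open import Data.Fin.Subset using (Subset; ∣_∣; _-_; ∁) renaming (_∈_ to _∈ₛ_)
open import Data.Fin.Subset.Properties using (x∈p⇒∣p-x∣<∣p∣; x∈p∧x≢y⇒x∈p-y; ∣∁p∣≡n∸∣p∣; ∣p∣≤n)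
import Data.Vec as Vec
open import Data.Vec.Properties using (lookup∘tabulate; lookup⇒[]=; tabulate-∘)
open import Data.Maybe using (Maybe; just; nothing)
open import Data.Maybe.Properties using (just-injective)
open import Data.List
  using (List; []; _∷_; [_]; _++_; _ʳ++_; reverse; length; lookup; map; concatMap; filter; allFin; fromMaybe; head; drop)
import Data.List as List
open import Data.List.Properties
  using (length-map; length-++; length-++-sucʳ; length-++-≤ˡ; length-ʳ++; ʳ++-defn; filter-all; filter-accept; filter-reject)
open import Data.List.Relation.Unary.All as All using (All; []; _∷_)
import Data.List.Relation.Unary.All.Properties as All
open import Data.List.Relation.Unary.Any using (here; there)
import Data.List.Relation.Unary.Any.Properties as Any
import Data.List.Relation.Unary.AllPairs as AllPairs
import Data.List.Relation.Unary.AllPairs.Properties as AllPairs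
open import Data.List.Relation.Unary.Linked as Linked using (Linked; [-]; _∷_)
open import Data.List.Relation.Unary.Unique.Propositional using (Unique; []; _∷_)
import Data.List.Relation.Unary.Unique.Propositional.Properties as Unique
open import Data.List.Membership.Propositional using (_∈_; _∉_)
open import Data.List.Membership.Propositional.Properties using (∈-lookup; ∈-∃++; ∈-++⁺ʳ; ∈-map⁻; ∈-filter⁺; ∈-allFin)
import Data.List.Membership.DecPropositional as DecMembership
open import Data.Product using (∃; ∃₂; _×_; _,_; proj₁; proj₂)
open import Data.Sum using (_⊎_; inj₁; inj₂)
open import Function using (_∘_; id)
open import Level using (0ℓ)
open import Relation.Nullary using (¬_; yes; no; does; contradiction)
open import Relation.Nullary.Decidable using (T?)
open import Relation.Unary using (Pred; Decidable)
open import Relation.Binary.Core using (Rel)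
open import Relation.Binary.Definitions using (DecidableEquality)
open import Relation.Binary.PropositionalEquality as ≡ using (_≡_; _≢_; refl; cong; cong₂; subst; module ≡-Reasoning)
open import Algebra.Properties.Semiring.Sum +-*-semiring using (sum-syntax; *-distribˡ-sum; *-distribʳ-sum; sum-cong-≗)
open import Algebra.Properties.CommutativeMonoid.Sum +-0-commutativeMonoid using (∑-comm)

geometric : ℕ → ℕ → ℕ
geometric q zero    = 0
geometric q (suc m) = 1 + q * geometric q m

N₁′ : ℕ → ℕ → ℕ → ℕ
N₁′ r s m = 1 + (r * (s ∸ 1)) * geometric ((r ∸ 1) * (s ∸ 1)) m

^≡1+pred*geometric : ∀ p m → suc p ^ m ≡ 1 + p * geometric (suc p) m
^≡1+pred*geometric p zero    = cong suc (≡.sym (*-zeroʳ p))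
^≡1+pred*geometric p (suc m) = ≡.trans (cong (suc p *_) (^≡1+pred*geometric p m)) (horner p _)
  where
  horner : ∀ p G → suc p * (1 + p * G) ≡ 1 + p * (1 + suc p * G)
  horner = solve-∀

geometric-quotient : ∀ {q} m → 2 ≤ q → (q ^ m ∸ 1) div (q ∸ 1) ≡ geometric q m
geometric-quotient {suc (suc p)} m (s≤s (s≤s _))
  rewrite ^≡1+pred*geometric (suc p) m | *-comm (suc p) (geometric (suc (suc p)) m)
  = m*n/n≡m (geometric (suc (suc p)) m) (suc p)

m-div-n*n≤m : ∀ m n → (m div n) * n ≤ m
m-div-n*n≤m m zero    = z≤n
m-div-n*n≤m m (suc n) = m/n*n≤m m (suc n)

σ*r≡ρ*s : ∀ r s → 0 < r → σ r s * r ≡ ρ r s * s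
σ*r≡ρ*s r s 0<r with gcd r s | gcd[m,n]∣m r s | gcd[m,n]∣n r s
... | zero  | divides a r≡a*0 | _ = contradiction (≡.trans r≡a*0 (*-zeroʳ a)) (n>0⇒n≢0 0<r)
... | suc g | divides a r≡a*g | divides b s≡b*g = begin
  s / suc g * r                   ≡⟨ cong₂ (λ x y → x / suc g * y) s≡b*g r≡a*g ⟩
  b * suc g / suc g * (a * suc g) ≡⟨ cong (_* (a * suc g)) (m*n/n≡m b (suc g)) ⟩
  b * (a * suc g)                 ≡⟨ swap b a (suc g) ⟩
  a * (b * suc g)                 ≡⟨ cong (_* (b * suc g)) (m*n/n≡m a (suc g)) ⟨
  a * suc g / suc g * (b * suc g) ≡⟨ cong₂ (λ x y → x / suc g * y) r≡a*g s≡b*g ⟨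
  r / suc g * s                   ∎
  where
  open ≡-Reasoning
  swap : ∀ b a g → b * (a * g) ≡ a * (b * g)
  swap = solve-∀

N₂′-as-geometric : ∀ {r s} m → 2 ≤ s → s < r →
  N₂′ r s m ≡ 1 + (s * (r ∸ 1)) * geometric ((r ∸ 1) * (s ∸ 1)) m
N₂′-as-geometric {suc r} {suc s} m (s≤s 1≤s) (s≤s s<r) =
  cong (λ x → 1 + (suc s * r) * x) (geometric-quotient m (*-mono-≤ (≤-trans (s≤s 1≤s) s<r) 1≤s))

-- r N₁′ − s N₂′ = (r − s)(1 + ((r − 1)(s − 1) − 1) Y), written here with r = 3 + e + d, s = 2 + e.
N₂′*s<N₁′*r : ∀ {r s} m → 2 ≤ s → s < r → N₂′ r s m * s < N₁′ r s m * r
N₂′*s<N₁′*r {r} {suc (suc e)} m 2≤s@(s≤s (s≤s _)) s<r with m≤n⇒∃[o]m+o≡n s<r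
... | d , refl = begin-strict
  N₂′ r s m * s                  ≡⟨ cong (_* s) (N₂′-as-geometric m 2≤s s<r) ⟩
  (1 + (s * (r ∸ 1)) * Y) * s    <⟨ m<m+n _ 0<1+n ⟩
  (1 + (s * (r ∸ 1)) * Y) * s + suc (d + (1 + d) * (1 + 3 * e + e * e + d + d * e) * Y)
                                 ≡⟨ difference d e Y ⟨
  N₁′ r s m * r                  ∎
  where
  open ≤-Reasoning
  s Y : ℕ
  s = suc (suc e)
  Y = geometric ((r ∸ 1) * (s ∸ 1)) m
  difference : ∀ d e Y → (1 + (3 + e + d) * (1 + e) * Y) * (3 + e + d)
    ≡ (1 + (2 + e) * (2 + e + d) * Y) * (2 + e) + suc (d + (1 + d) * (1 + 3 * e + e * e + d + d * e) * Y)
  difference = solve-∀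

proportional-part : ∀ {a b r s t ρ σ} .{{_ : NonZero (r + s)}} →
  a * r ≡ b * s → a + b ≡ t * (ρ + σ) → σ * r ≡ ρ * s → b ≡ t * ρ
proportional-part {a} {b} {r} {s} {t} {ρ} {σ} ar≡bs a+b≡t[ρ+σ] σr≡ρs =
  *-cancelʳ-≡ b (t * ρ) (r + s) (begin
    b * (r + s)             ≡⟨ *-distribˡ-+ b r s ⟩
    b * r + b * s           ≡⟨ cong (b * r +_) ar≡bs ⟨
    b * r + a * r           ≡⟨ *-distribʳ-+ r b a ⟨
    (b + a) * r             ≡⟨ cong (_* r) (≡.trans (+-comm b a) a+b≡t[ρ+σ]) ⟩
    t * (ρ + σ) * r         ≡⟨ split t ρ σ r ⟩
    t * ρ * r + t * (σ * r) ≡⟨ cong (λ x → t * ρ * r + t * x) σr≡ρs ⟩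
    t * ρ * r + t * (ρ * s) ≡⟨ join t ρ r s ⟩
    t * ρ * (r + s)         ∎)
  where
  open ≡-Reasoning
  split : ∀ t ρ σ r → t * (ρ + σ) * r ≡ t * ρ * r + t * (σ * r)
  split = solve-∀
  join : ∀ t ρ r s → t * ρ * r + t * (ρ * s) ≡ t * ρ * (r + s)
  join = solve-∀

M-order⇒n₁<N₁′ : ∀ {r s} m {n₁ n₂} → 2 ≤ s → s < r →
  n₁ * r ≡ n₂ * s → n₁ + n₂ ≡ M r s m → n₁ < N₁′ r s m
M-order⇒n₁<N₁′ {r} {s} m {n₁} {n₂} 2≤s s<r n₁r≡n₂s n₁+n₂≡M = *-cancelʳ-< r n₁ (N₁′ r s m) (begin-strict
  n₁ * r                            ≡⟨ n₁r≡n₂s ⟩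
  n₂ * s                            ≡⟨ cong (_* s) n₂≡tρ ⟩
  (N₂′ r s m div ρ r s) * ρ r s * s ≤⟨ *-monoˡ-≤ s (m-div-n*n≤m (N₂′ r s m) (ρ r s)) ⟩
  N₂′ r s m * s                     <⟨ N₂′*s<N₁′*r m 2≤s s<r ⟩
  N₁′ r s m * r                     ∎)
  where
  open ≤-Reasoning
  0<r : 0 < r
  0<r = <-trans (≤-trans (s≤s z≤n) 2≤s) s<r
  instance
    r+s≢0 : NonZero (r + s)
    r+s≢0 = >-nonZero (≤-trans 0<r (m≤m+n r s))
  n₂≡tρ : n₂ ≡ (N₂′ r s m div ρ r s) * ρ r s
  n₂≡tρ = proportional-part {t = N₂′ r s m div ρ r s} {ρ r s} {σ r s} n₁r≡n₂s n₁+n₂≡M (σ*r≡ρ*s r s 0<r)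

last⁺ : ∀ {A : Set} → A → List A → A
last⁺ x []       = x
last⁺ _ (y ∷ ys) = last⁺ y ys

last⁺∈ : ∀ {A : Set} (x : A) xs → last⁺ x xs ∈ x ∷ xs
last⁺∈ x []       = here refl
last⁺∈ _ (y ∷ ys) = there (last⁺∈ y ys)

length-filter-tabulate : ∀ {A : Set} {P : Pred A 0ℓ} (P? : Decidable P) {n} (g : Fin n → A) →
  length (filter P? (List.tabulate g)) ≡ ∣ Vec.tabulate (does ∘ P? ∘ g) ∣
length-filter-tabulate P? {zero}  g = refl
length-filter-tabulate P? {suc n} g with does (P? (g zero))
... | true  = cong suc (length-filter-tabulate P? (g ∘ suc))
... | false = length-filter-tabulate P? (g ∘ suc)

length-concatMap : ∀ {A B : Set} (f : A → List B) {ℓ} {xs} →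
  All (λ x → length (f x) ≡ ℓ) xs → length (concatMap f xs) ≡ length xs * ℓ
length-concatMap f []                               = refl
length-concatMap f {xs = x ∷ xs} (fx≡ℓ ∷ fxs≡ℓ) =
  ≡.trans (length-++ (f x)) (cong₂ _+_ fx≡ℓ (length-concatMap f fxs≡ℓ))

Unique-concatMap⁺ : ∀ {A B : Set} (key : B → Maybe A) {f : A → List B} {xs} →
  Unique xs → (∀ x → Unique (f x)) → (∀ x → All (λ b → key b ≡ just x) (f x)) →
  Unique (concatMap f xs)
Unique-concatMap⁺ key {f} {xs} xs! f! keyed =
  Unique.concat⁺ (All.map⁺ (All.universal f! xs)) (AllPairs.map⁺ (AllPairs.map disjoint xs!))
  where
  disjoint : ∀ {x y} → x ≢ y → ∀ {b} → ¬ (b ∈ f x × b ∈ f y)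
  disjoint x≢y (b∈fx , b∈fy) =
    x≢y (just-injective (≡.trans (≡.sym (All.lookup (keyed _) b∈fx)) (All.lookup (keyed _) b∈fy)))

module _ {A : Set} where

  Unique-++⁻ˡ : ∀ (xs : List A) {ys} → Unique (xs ++ ys) → Unique xs
  Unique-++⁻ˡ []       _           = []
  Unique-++⁻ˡ (x ∷ xs) (x∉ ∷ xs!) = All.++⁻ˡ xs x∉ ∷ Unique-++⁻ˡ xs xs!

  Unique-++⇒disjoint : ∀ (xs : List A) {ys e} → Unique (xs ++ ys) → e ∈ xs → e ∉ ys
  Unique-++⇒disjoint (x ∷ xs) (x∉ ∷ _)   (here refl)  e∈ys = All.lookup x∉ (∈-++⁺ʳ xs e∈ys) refl
  Unique-++⇒disjoint (x ∷ xs) (_  ∷ xs!) (there e∈xs) e∈ys = Unique-++⇒disjoint xs xs! e∈xs e∈ys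

  Unique⇒lookup-injective : ∀ {xs : List A} → Unique xs → ∀ {i j} → lookup xs i ≡ lookup xs j → i ≡ j
  Unique⇒lookup-injective (_  ∷ _)   {zero}  {zero}  _  = refl
  Unique⇒lookup-injective (x∉ ∷ _)   {zero}  {suc j} eq = contradiction eq (All.lookup x∉ (∈-lookup j))
  Unique⇒lookup-injective (x∉ ∷ _)   {suc i} {zero}  eq = contradiction (≡.sym eq) (All.lookup x∉ (∈-lookup i))
  Unique⇒lookup-injective (_  ∷ xs!) {suc i} {suc j} eq = cong suc (Unique⇒lookup-injective xs! eq)

  module _ (_≟ᴬ_ : DecidableEquality A) where

    open DecMembership _≟ᴬ_ using (_∉?_)

    suc-length-filter-∉[_] : ∀ a {xs : List A} → Unique xs → a ∈ xs →
      suc (length (filter (_∉? [ a ]) xs)) ≡ length xs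
    suc-length-filter-∉[ a ] {a ∷ xs} (a∉xs ∷ _) (here refl) = cong (suc ∘ length) (≡.trans
      (filter-reject (_∉? [ a ]) (λ a∉[a] → a∉[a] (here refl)))
      (filter-all (_∉? [ a ]) (All.map (λ a≢y → λ { (here y≡a) → a≢y (≡.sym y≡a) }) a∉xs)))
    suc-length-filter-∉[ a ] {x ∷ xs} (x∉xs ∷ xs!) (there a∈xs) = ≡.trans
      (cong (suc ∘ length) (filter-accept (_∉? [ a ]) (λ { (here x≡a) → All.lookup x∉xs a∈xs x≡a })))
      (cong suc (suc-length-filter-∉[ a ] xs! a∈xs))

  module _ {R : Rel A 0ℓ} where

    Linked-++⁻ : ∀ xs {y ys} → Linked R (xs ++ y ∷ ys) → Linked R (xs ++ [ y ])
    Linked-++⁻ []            _        = [-]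
    Linked-++⁻ (x ∷ [])      (r ∷ _)  = r ∷ [-]
    Linked-++⁻ (x ∷ x′ ∷ xs) (r ∷ rs) = r ∷ Linked-++⁻ (x′ ∷ xs) rs

    Linked⇒lookup : ∀ {x} xs {ys} → Linked R (x ∷ xs ++ ys) →
      ∀ (i : Fin (length xs)) → R (lookup (x ∷ xs) (inject₁ i)) (lookup (x ∷ xs) (suc i))
    Linked⇒lookup (_ ∷ _)  (r ∷ _)  zero    = r
    Linked⇒lookup (_ ∷ xs) (_ ∷ rs) (suc i) = Linked⇒lookup xs rs i

    Linked⇒last : ∀ {x} xs {y} → Linked R (x ∷ xs ++ [ y ]) → R (lookup (x ∷ xs) (fromℕ (length xs))) y
    Linked⇒last []       (r ∷ _)  = r
    Linked⇒last (_ ∷ xs) (_ ∷ rs) = Linked⇒last xs rs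

V₁ V₂ : ∀ {n} → (Fin n → Bool) → Subset n
V₁ part = Vec.tabulate (not ∘ part)
V₂ part = Vec.tabulate part

module _ {n : ℕ} where

  open DecMembership (_≟_ {n}) using (_∈?_)

  ∈ₛ-tabulate⁺ : ∀ {f : Fin n → Bool} {x} → f x ≡ true → x ∈ₛ Vec.tabulate f
  ∈ₛ-tabulate⁺ {f} {x} fx≡true = lookup⇒[]= x _ (≡.trans (lookup∘tabulate f x) fx≡true)

  ∣V₁∣+∣V₂∣≡n : ∀ (part : Fin n → Bool) → ∣ V₁ part ∣ + ∣ V₂ part ∣ ≡ n
  ∣V₁∣+∣V₂∣≡n part = begin
    ∣ V₁ part ∣ + ∣ p ∣ ≡⟨ cong (λ p′ → ∣ p′ ∣ + ∣ p ∣) (tabulate-∘ not part) ⟩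
    ∣ ∁ p ∣ + ∣ p ∣     ≡⟨ cong (_+ ∣ p ∣) (∣∁p∣≡n∸∣p∣ p) ⟩
    n ∸ ∣ p ∣ + ∣ p ∣   ≡⟨ m∸n+n≡m (∣p∣≤n p) ⟩
    n                   ∎
    where
    open ≡-Reasoning
    p : Subset n
    p = V₂ part

  pigeonhole : ∀ {A : Set} {p : Subset n} (f : A → Fin n) {xs : List A} →
    ∣ p ∣ < length xs → Unique xs → All (λ x → f x ∈ₛ p) xs →
    ∃₂ λ x y → x ∈ xs × y ∈ xs × x ≢ y × f x ≡ f y
  pigeonhole {p = p} f {x ∷ xs} ∣p∣<1+∣xs∣ (x∉xs ∷ xs!) (fx∈p ∷ fxs∈p) with f x ∈? map f xs
  ... | yes fx∈fxs = let y , y∈xs , fx≡fy = ∈-map⁻ f fx∈fxs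
                     in  x , y , here refl , there y∈xs , All.lookup x∉xs y∈xs , fx≡fy
  ... | no  fx∉fxs = let x′ , y , x′∈xs , y∈xs , x′≢y , fx′≡fy = pigeonhole f ∣p-fx∣<∣xs∣ xs! fxs∈p-fx
                     in  x′ , y , there x′∈xs , there y∈xs , x′≢y , fx′≡fy
    where
    ∣p-fx∣<∣xs∣ : ∣ p - f x ∣ < length xs
    ∣p-fx∣<∣xs∣ = <-≤-trans (x∈p⇒∣p-x∣<∣p∣ fx∈p) (s≤s⁻¹ ∣p∣<1+∣xs∣)
    fxs∈p-fx : All (λ y → f y ∈ₛ p - f x) xs
    fxs∈p-fx = All.zipWith (λ (fy∈p , fx≢fy) → x∈p∧x≢y⇒x∈p-y fy∈p (fx≢fy ∘ ≡.sym))
                           (fxs∈p , All.¬Any⇒All¬ xs (fx∉fxs ∘ Any.map⁺))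

𝟙 : Bool → ℕ
𝟙 true  = 1
𝟙 false = 0

∣tabulate∣≡∑𝟙 : ∀ {n} (f : Fin n → Bool) → ∣ Vec.tabulate f ∣ ≡ ∑[ i < n ] 𝟙 (f i)
∣tabulate∣≡∑𝟙 {zero}  f = refl
∣tabulate∣≡∑𝟙 {suc n} f with f zero
... | true  = cong suc (∣tabulate∣≡∑𝟙 (f ∘ suc))
... | false = ∣tabulate∣≡∑𝟙 (f ∘ suc)

-- Cycles from non-backtracking walks

module _ {n} (G : Graph n) where

  open DecMembership (_≟_ {n}) using (_∈?_; _∉?_)

  private
    V : Set
    V = Fin n
    IsWalk : List V → Set
    IsWalk = Linked (Adj G)

  adj-sym : ∀ {u v} → Adj G u v → Adj G v u
  adj-sym {u} {v} = subst T (Graph.sym G u v)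

  adj-irrefl : ∀ {v} → ¬ Adj G v v
  adj-irrefl {v} = subst T (irrefl G v)

  NonBacktracking : List V → Set
  NonBacktracking (x ∷ y ∷ z ∷ zs) = x ≢ z × NonBacktracking (y ∷ z ∷ zs)
  NonBacktracking _                = ⊤

  NonBacktracking-tail : ∀ {x} xs → NonBacktracking (x ∷ xs) → NonBacktracking xs
  NonBacktracking-tail []          _        = _
  NonBacktracking-tail (_ ∷ [])    _        = _
  NonBacktracking-tail (_ ∷ _ ∷ _) (_ , nb) = nb

  GirthLE-mono : ∀ {g h} → g ≤ h → GirthLE G g → GirthLE G h
  GirthLE-mono g≤h (j , 3+j≤g , c) = j , ≤-trans 3+j≤g g≤h , c

  closed-path⇒Cycle : ∀ {x y z} us → Unique (x ∷ y ∷ z ∷ us) →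
    IsWalk ((x ∷ y ∷ z ∷ us) ++ [ x ]) → Cycle G (length us)
  closed-path⇒Cycle us xyzus! closed = record
    { vtx    = lookup (_ ∷ _ ∷ _ ∷ us)
    ; inj    = Unique⇒lookup-injective xyzus!
    ; consec = Linked⇒lookup (_ ∷ _ ∷ us) closed
    ; close  = Linked⇒last (_ ∷ _ ∷ us) closed
    }

  nonBacktracking-revisit⇒cycle : ∀ {x} ws → IsWalk (x ∷ ws) → NonBacktracking (x ∷ ws) →
    Unique ws → x ∈ ws → GirthLE G (length ws)
  nonBacktracking-revisit⇒cycle {x} ws walk nb ws! x∈ws with ∈-∃++ x∈ws
  ... | []         , zs , refl = contradiction (Linked.head walk) adj-irrefl
  ... | y ∷ []     , zs , refl = contradiction refl (proj₁ nb)
  ... | y ∷ z ∷ us , zs , refl =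
    length us , s≤s (s≤s length-bound) ,
    closed-path⇒Cycle us (x∉ ∷ Unique-++⁻ˡ (y ∷ z ∷ us) ws!) (Linked-++⁻ (x ∷ y ∷ z ∷ us) walk)
    where
    x∉ : All (x ≢_) (y ∷ z ∷ us)
    x∉ = All.¬Any⇒All¬ _ (λ x∈ → Unique-++⇒disjoint (y ∷ z ∷ us) ws! x∈ (here refl))
    length-bound : suc (length us) ≤ length (us ++ x ∷ zs)
    length-bound = subst (suc (length us) ≤_) (≡.sym (length-++-sucʳ us x zs)) (s≤s (length-++-≤ˡ us))

  nonBacktracking⇒path⊎cycle : ∀ ws → IsWalk ws → NonBacktracking ws →
    Unique ws ⊎ GirthLE G (length ws ∸ 1)
  nonBacktracking⇒path⊎cycle []           _    _  = inj₁ []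
  nonBacktracking⇒path⊎cycle (x ∷ [])     _    _  = inj₁ ([] ∷ [])
  nonBacktracking⇒path⊎cycle (x ∷ y ∷ ws) walk nb
    with nonBacktracking⇒path⊎cycle (y ∷ ws) (Linked.tail walk) (NonBacktracking-tail (y ∷ ws) nb)
  ... | inj₂ cycle = inj₂ (GirthLE-mono (m∸n≤m _ 1) cycle)
  ... | inj₁ yws! with x ∈? y ∷ ws
  ...   | yes x∈ = inj₂ (nonBacktracking-revisit⇒cycle (y ∷ ws) walk nb yws! x∈)
  ...   | no  x∉ = inj₁ (All.¬Any⇒All¬ _ x∉ ∷ yws!)

  Diverge : List V → List V → Set
  Diverge (x ∷ _) (y ∷ _) = x ≢ y
  Diverge _       _       = ⊤

  Linked-ʳ++ : ∀ xs {c ys} → IsWalk (c ∷ xs) → IsWalk (c ∷ ys) → IsWalk (xs ʳ++ c ∷ ys)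
  Linked-ʳ++ []       _         walk = walk
  Linked-ʳ++ (x ∷ xs) (cx ∷ lx) walk = Linked-ʳ++ xs lx (adj-sym cx ∷ walk)

  NonBacktracking-ʳ++ : ∀ xs {c ys} → NonBacktracking (c ∷ xs) → NonBacktracking (c ∷ ys) →
    Diverge xs ys → NonBacktracking (xs ʳ++ c ∷ ys)
  NonBacktracking-ʳ++ []       _  nb _ = nb
  NonBacktracking-ʳ++ (x ∷ xs) {c} {ys} nx nb x≢y =
    NonBacktracking-ʳ++ xs (NonBacktracking-tail (x ∷ xs) nx) (turn ys nb x≢y) (diverge xs nx)
    where
    turn : ∀ ys → NonBacktracking (c ∷ ys) → Diverge (x ∷ xs) ys → NonBacktracking (x ∷ c ∷ ys)
    turn []      _  _   = _
    turn (_ ∷ _) nb x≢y = x≢y , nb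
    diverge : ∀ xs → NonBacktracking (c ∷ x ∷ xs) → Diverge xs (c ∷ ys)
    diverge []      _         = _
    diverge (_ ∷ _) (c≢z , _) = c≢z ∘ ≡.sym

  -- The glued walk starts and ends at the common endpoint, so it cannot be a path.
  divergent-walks⇒cycle : ∀ {v} P {q} Q → IsWalk (v ∷ P) → IsWalk (v ∷ q ∷ Q) →
    NonBacktracking (v ∷ P) → NonBacktracking (v ∷ q ∷ Q) → Diverge P (q ∷ Q) →
    last⁺ v P ≡ last⁺ q Q → GirthLE G (length P + length (q ∷ Q))
  divergent-walks⇒cycle {v} P {q} Q wP wQ nP nQ P⋏Q same-end
    with nonBacktracking⇒path⊎cycle ((v ∷ P) ʳ++ q ∷ Q) (Linked-ʳ++ P wP wQ) (NonBacktracking-ʳ++ P nP nQ P⋏Q)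
  ... | inj₂ cycle = subst (GirthLE G) (cong (_∸ 1) (length-ʳ++ (v ∷ P))) cycle
  ... | inj₁ glued! = ⊥-elim (Unique-++⇒disjoint (reverse (v ∷ P)) (subst Unique (ʳ++-defn (v ∷ P)) glued!)
                        (Any.reverse⁺ (last⁺∈ v P)) (subst (_∈ q ∷ Q) (≡.sym same-end) (last⁺∈ q Q)))

  distinct-walks-same-end⇒cycle : ∀ {v} P Q → IsWalk (v ∷ P) → IsWalk (v ∷ Q) →
    NonBacktracking (v ∷ P) → NonBacktracking (v ∷ Q) → P ≢ Q →
    last⁺ v P ≡ last⁺ v Q → GirthLE G (length P + length Q)
  distinct-walks-same-end⇒cycle []      []      _  _  _  _  P≢Q _ = contradiction refl P≢Q
  distinct-walks-same-end⇒cycle []      (q ∷ Q) wP wQ nP nQ _ same-end =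
    divergent-walks⇒cycle [] Q wP wQ nP nQ _ same-end
  distinct-walks-same-end⇒cycle (p ∷ P) []      wP wQ nP nQ _ same-end =
    subst (GirthLE G) (≡.sym (+-identityʳ _)) (divergent-walks⇒cycle [] P wQ wP nQ nP _ (≡.sym same-end))
  distinct-walks-same-end⇒cycle (p ∷ P) (q ∷ Q) wP wQ nP nQ P≢Q same-end with p ≟ q
  ... | no  p≢q  = divergent-walks⇒cycle (p ∷ P) Q wP wQ nP nQ p≢q same-end
  ... | yes refl = GirthLE-mono (+-mono-≤ (n≤1+n _) (n≤1+n _))
    (distinct-walks-same-end⇒cycle P Q (Linked.tail wP) (Linked.tail wQ)
      (NonBacktracking-tail (p ∷ P) nP) (NonBacktracking-tail (p ∷ Q) nQ) (P≢Q ∘ cong (p ∷_)) same-end)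

-- Non-backtracking walks of bounded even length

module _ {n} (G : Graph n) where

  open DecMembership (_≟_ {n}) using (_∉?_)

  private
    V : Set
    V = Fin n

  neighbours : V → List V
  neighbours u = filter (T? ∘ adj G u) (allFin n)

  successors : Maybe V → V → List V
  successors p c = filter (_∉? fromMaybe p) (neighbours c)

  length-neighbours : ∀ u → length (neighbours u) ≡ degree G u
  length-neighbours u = length-filter-tabulate (T? ∘ adj G u) id

  neighbours-unique : ∀ u → Unique (neighbours u)
  neighbours-unique u = Unique.filter⁺ _ (Unique.allFin⁺ n)

  successors-adj : ∀ p c → All (λ y → Adj G c y × y ∉ fromMaybe p) (successors p c)
  successors-adj p c =
    All.zipWith id (All.filter⁺ _ (All.all-filter _ (allFin n)) , All.all-filter _ (neighbours c))

  length-successors : ∀ {a c} → Adj G c a → suc (length (successors (just a) c)) ≡ degree G c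
  length-successors {a} {c} ca = ≡.trans
    (suc-length-filter-∉[_] _≟_ a (neighbours-unique c) (∈-filter⁺ (T? ∘ adj G c) (∈-allFin a) ca))
    (length-neighbours c)

  ∃-neighbour : ∀ u → 0 < degree G u → ∃ (Adj G u)
  ∃-neighbour u 0<deg = nonempty (neighbours u) (All.all-filter (T? ∘ adj G u) (allFin n))
    (subst (0 <_) (≡.sym (length-neighbours u)) 0<deg)
    where
    nonempty : ∀ xs → All (Adj G u) xs → 0 < length xs → ∃ (Adj G u)
    nonempty (x ∷ _) (ux ∷ _) _ = x , ux

  -- evenWalks k p c lists the tails R of the walks c ∷ R of even length ≤ 2k that are
  -- non-backtracking and whose first step does not return to p.
  evenWalks : ℕ → Maybe V → V → List (List V)
  evenWalksVia : ℕ → V → V → List (List V)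
  evenWalks zero    p c = [ [] ]
  evenWalks (suc k) p c = [] ∷ concatMap (evenWalksVia k c) (successors p c)
  evenWalksVia k c y =
    concatMap (λ z → map (λ R → y ∷ z ∷ R) (evenWalks k (just y) z)) (successors (just c) y)

  evenWalks-unique : ∀ k p c → Unique (evenWalks k p c)
  evenWalks-unique zero    p c = [] ∷ []
  evenWalks-unique (suc k) p c =
    All.concat⁺ (All.map⁺ (All.universal (λ y → All.map []≢ (evenWalksVia-head y)) (successors p c))) ∷
    Unique-concatMap⁺ head (Unique.filter⁺ _ (neighbours-unique c)) evenWalksVia-unique evenWalksVia-head
    where
    []≢ : ∀ {y R} → head R ≡ just y → [] ≢ R
    []≢ head≡just refl = contradiction head≡just λ ()
    evenWalksVia-head : ∀ y → All (λ R → head R ≡ just y) (evenWalksVia k c y)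
    evenWalksVia-head y = All.concat⁺ (All.map⁺ (All.universal
      (λ z → All.map⁺ (All.universal (λ _ → refl) (evenWalks k (just y) z))) (successors (just c) y)))
    evenWalksVia-unique : ∀ y → Unique (evenWalksVia k c y)
    evenWalksVia-unique y =
      Unique-concatMap⁺ (head ∘ drop 1) (Unique.filter⁺ _ (neighbours-unique y))
        (λ z → Unique.map⁺ (λ { refl → refl }) (evenWalks-unique k (just y) z))
        (λ z → All.map⁺ (All.universal (λ _ → refl) (evenWalks k (just y) z)))

-- Bipartite biregular graphs

module _ {n} (G : Graph n) {part : Fin n → Bool} (bip : IsBipartition G part) where

  private
    V : Set
    V = Fin n

  adj⇒part≡not : ∀ {u v} → Adj G u v → part v ≡ not (part u)
  adj⇒part≡not {u} {v} uv with part u in pu | part v in pv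
  ... | false | false = contradiction (≡.trans pu (≡.sym pv)) (bip u v uv)
  ... | false | true  = refl
  ... | true  | false = refl
  ... | true  | true  = contradiction (≡.trans pu (≡.sym pv)) (bip u v uv)

  two-steps-same-side : ∀ {c y z} → Adj G c y → Adj G y z → part z ≡ part c
  two-steps-same-side {c} {y} {z} cy yz = begin
    part z             ≡⟨ adj⇒part≡not yz ⟩
    not (part y)       ≡⟨ cong not (adj⇒part≡not cy) ⟩
    not (not (part c)) ≡⟨ not-involutive (part c) ⟩
    part c             ∎
    where open ≡-Reasoning

  𝟙-edge-sym : ∀ u v → 𝟙 (not (part u)) * 𝟙 (adj G u v) ≡ 𝟙 (part v) * 𝟙 (adj G v u)
  𝟙-edge-sym u v rewrite Graph.sym G v u with adj G u v in uv
  ... | false = ≡.trans (*-zeroʳ (𝟙 (not (part u)))) (≡.sym (*-zeroʳ (𝟙 (part v))))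
  ... | true  = cong (λ b → 𝟙 b * 1) (≡.sym (adj⇒part≡not (subst T (≡.sym uv) _)))

  bipartite-handshake : ∑[ u < n ] (𝟙 (not (part u)) * degree G u) ≡ ∑[ v < n ] (𝟙 (part v) * degree G v)
  bipartite-handshake = begin
    ∑[ u < n ] (𝟙 (not (part u)) * degree G u)
      ≡⟨ sum-cong-≗ (λ u → cong (𝟙 (not (part u)) *_) (∣tabulate∣≡∑𝟙 (adj G u))) ⟩
    ∑[ u < n ] (𝟙 (not (part u)) * ∑[ v < n ] 𝟙 (adj G u v))
      ≡⟨ sum-cong-≗ (λ u → *-distribˡ-sum (𝟙 (not (part u))) (𝟙 ∘ adj G u)) ⟩
    ∑[ u < n ] ∑[ v < n ] (𝟙 (not (part u)) * 𝟙 (adj G u v))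
      ≡⟨ ∑-comm (λ u v → 𝟙 (not (part u)) * 𝟙 (adj G u v)) ⟩
    ∑[ v < n ] ∑[ u < n ] (𝟙 (not (part u)) * 𝟙 (adj G u v))
      ≡⟨ sum-cong-≗ (λ v → sum-cong-≗ (λ u → 𝟙-edge-sym u v)) ⟩
    ∑[ v < n ] ∑[ u < n ] (𝟙 (part v) * 𝟙 (adj G v u))
      ≡⟨ sum-cong-≗ (λ v → *-distribˡ-sum (𝟙 (part v)) (𝟙 ∘ adj G v)) ⟨
    ∑[ v < n ] (𝟙 (part v) * ∑[ u < n ] 𝟙 (adj G v u))
      ≡⟨ sum-cong-≗ (λ v → cong (𝟙 (part v) *_) (∣tabulate∣≡∑𝟙 (adj G v))) ⟨
    ∑[ v < n ] (𝟙 (part v) * degree G v) ∎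
    where open ≡-Reasoning

  record IsEvenWalk (k : ℕ) (p : Maybe V) (c : V) (R : List V) : Set where
    field
      linked          : Linked (Adj G) (c ∷ R)
      nonBacktracking : NonBacktracking G (fromMaybe p ++ c ∷ R)
      length≤         : length R ≤ 2 * k
      same-side       : part (last⁺ c R) ≡ part c

  []-isEvenWalk : ∀ {k} p {c} → IsEvenWalk k p c []
  []-isEvenWalk p {c} = record
    { linked = [-] ; nonBacktracking = nb p ; length≤ = z≤n ; same-side = refl }
    where
    nb : ∀ p → NonBacktracking G (fromMaybe p ++ [ c ])
    nb nothing  = _
    nb (just _) = _

  ∷∷-isEvenWalk : ∀ {k p c y z R} → Adj G c y → y ∉ fromMaybe p → Adj G y z → z ∉ [ c ] →
    IsEvenWalk k (just y) z R → IsEvenWalk (suc k) p c (y ∷ z ∷ R)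
  ∷∷-isEvenWalk {k} {p} {c} {y} {z} {R} cy y∉p yz z∉[c] w = record
    { linked          = cy ∷ yz ∷ linked
    ; nonBacktracking = nb p y∉p
    ; length≤         = ≤-trans (s≤s (s≤s length≤)) (≤-reflexive (≡.sym (*-suc 2 k)))
    ; same-side       = ≡.trans same-side (two-steps-same-side cy yz)
    }
    where
    open IsEvenWalk w
    c≢z : c ≢ z
    c≢z c≡z = z∉[c] (here (≡.sym c≡z))
    nb : ∀ p → y ∉ fromMaybe p → NonBacktracking G (fromMaybe p ++ c ∷ y ∷ z ∷ R)
    nb nothing  _     = c≢z , nonBacktracking
    nb (just a) y∉[a] = (λ a≡y → y∉[a] (here (≡.sym a≡y))) , c≢z , nonBacktracking

  evenWalks-sound : ∀ k p c → All (IsEvenWalk k p c) (evenWalks G k p c)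
  evenWalks-sound zero    p c = []-isEvenWalk p ∷ []
  evenWalks-sound (suc k) p c =
    []-isEvenWalk p ∷ All.concat⁺ (All.map⁺ (All.map evenWalksVia-sound (successors-adj G p c)))
    where
    evenWalksVia-sound : ∀ {y} → Adj G c y × y ∉ fromMaybe p → All (IsEvenWalk (suc k) p c) (evenWalksVia G k c y)
    evenWalksVia-sound {y} (cy , y∉p) = All.concat⁺ (All.map⁺ (All.map
      (λ {z} (yz , z∉[c]) → All.map⁺ (All.map (∷∷-isEvenWalk cy y∉p yz z∉[c]) (evenWalks-sound k (just y) z)))
      (successors-adj G (just c) y)))

  module _ {r s : ℕ} (breg : Biregular G part r s) where

    private
      q : ℕ
      q = (r ∸ 1) * (s ∸ 1)

    ∣V₁∣*r≡∣V₂∣*s : ∣ V₁ part ∣ * r ≡ ∣ V₂ part ∣ * s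
    ∣V₁∣*r≡∣V₂∣*s = begin
      ∣ V₁ part ∣ * r                           ≡⟨ cong (_* r) (∣tabulate∣≡∑𝟙 (not ∘ part)) ⟩
      (∑[ u < n ] 𝟙 (not (part u))) * r         ≡⟨ *-distribʳ-sum r (𝟙 ∘ not ∘ part) ⟩
      ∑[ u < n ] (𝟙 (not (part u)) * r)         ≡⟨ sum-cong-≗ V₁-degree ⟩
      ∑[ u < n ] (𝟙 (not (part u)) * degree G u) ≡⟨ bipartite-handshake ⟩
      ∑[ v < n ] (𝟙 (part v) * degree G v)      ≡⟨ sum-cong-≗ V₂-degree ⟨
      ∑[ v < n ] (𝟙 (part v) * s)               ≡⟨ *-distribʳ-sum s (𝟙 ∘ part) ⟨
      (∑[ v < n ] 𝟙 (part v)) * s               ≡⟨ cong (_* s) (∣tabulate∣≡∑𝟙 part) ⟨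
      ∣ V₂ part ∣ * s                           ∎
      where
      open ≡-Reasoning
      V₁-degree : ∀ u → 𝟙 (not (part u)) * r ≡ 𝟙 (not (part u)) * degree G u
      V₁-degree u with part u in pu
      ... | false = cong (1 *_) (≡.sym (proj₁ breg u pu))
      ... | true  = refl
      V₂-degree : ∀ v → 𝟙 (part v) * s ≡ 𝟙 (part v) * degree G v
      V₂-degree v with part v in pv
      ... | false = refl
      ... | true  = cong (1 *_) (≡.sym (proj₂ breg v pv))

    length-evenWalks : ∀ k {a c} → part c ≡ false → Adj G a c →
      length (evenWalks G k (just a) c) ≡ geometric q (suc k)
    length-evenWalksVia : ∀ k {c y} → part c ≡ false → Adj G c y →
      length (evenWalksVia G k c y) ≡ (s ∸ 1) * geometric q (suc k)

    length-evenWalks zero    _ _ = cong suc (≡.sym (*-zeroʳ q))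
    length-evenWalks (suc k) {a} {c} pc ac = cong suc (begin
      length (concatMap (evenWalksVia G k c) (successors G (just a) c))
        ≡⟨ length-concatMap (evenWalksVia G k c)
             (All.map (λ (cy , _) → length-evenWalksVia k pc cy) (successors-adj G (just a) c)) ⟩
      length (successors G (just a) c) * ((s ∸ 1) * geometric q (suc k))
        ≡⟨ cong (_* _) (cong pred (≡.trans (length-successors G (adj-sym G ac)) (proj₁ breg c pc))) ⟩
      (r ∸ 1) * ((s ∸ 1) * geometric q (suc k))
        ≡⟨ *-assoc (r ∸ 1) (s ∸ 1) _ ⟨
      q * geometric q (suc k) ∎)
      where open ≡-Reasoning

    length-evenWalksVia k {c} {y} pc cy = begin
      length (evenWalksVia G k c y)
        ≡⟨ length-concatMap _ (All.map length-branch (successors-adj G (just c) y)) ⟩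
      length (successors G (just c) y) * geometric q (suc k)
        ≡⟨ cong (_* _) (cong pred (≡.trans (length-successors G (adj-sym G cy)) (proj₂ breg y py))) ⟩
      (s ∸ 1) * geometric q (suc k) ∎
      where
      open ≡-Reasoning
      py : part y ≡ true
      py = ≡.trans (adj⇒part≡not cy) (cong not pc)
      length-branch : ∀ {z} → Adj G y z × z ∉ [ c ] →
        length (map (λ R → y ∷ z ∷ R) (evenWalks G k (just y) z)) ≡ geometric q (suc k)
      length-branch {z} (yz , _) =
        ≡.trans (length-map _ (evenWalks G k (just y) z)) (length-evenWalks k (≡.trans (two-steps-same-side cy yz) pc) yz)

    length-evenWalks-root : ∀ m {v} → part v ≡ false → length (evenWalks G m nothing v) ≡ N₁′ r s m
    length-evenWalks-root zero    _ = cong suc (≡.sym (*-zeroʳ (r * (s ∸ 1))))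
    length-evenWalks-root (suc k) {v} pv = cong suc (begin
      length (concatMap (evenWalksVia G k v) (successors G nothing v))
        ≡⟨ length-concatMap (evenWalksVia G k v)
             (All.map (λ (vy , _) → length-evenWalksVia k pv vy) (successors-adj G nothing v)) ⟩
      length (successors G nothing v) * ((s ∸ 1) * geometric q (suc k))
        ≡⟨ cong (_* _) (≡.trans (cong length (filter-all _ (All.universal (λ _ ()) (neighbours G v))))
                                (≡.trans (length-neighbours G v) (proj₁ breg v pv))) ⟩
      r * ((s ∸ 1) * geometric q (suc k))
        ≡⟨ *-assoc r (s ∸ 1) _ ⟨
      r * (s ∸ 1) * geometric q (suc k) ∎)
      where open ≡-Reasoning

    ∣V₁∣<N₁′⇒GirthLE : ∀ m {v} → part v ≡ false → ∣ V₁ part ∣ < N₁′ r s m → GirthLE G (2 * m + 2 * m)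
    ∣V₁∣<N₁′⇒GirthLE m {v} pv ∣V₁∣<N₁′ =
      let P , Q , P∈ , Q∈ , P≢Q , same-end = pigeonhole (last⁺ v) ∣V₁∣<#walks (evenWalks-unique G m nothing v) ends∈V₁
          wP = All.lookup sound P∈
          wQ = All.lookup sound Q∈
          open IsEvenWalk
      in  GirthLE-mono G (+-mono-≤ (length≤ wP) (length≤ wQ))
            (distinct-walks-same-end⇒cycle G P Q (linked wP) (linked wQ)
               (nonBacktracking wP) (nonBacktracking wQ) P≢Q same-end)
      where
      sound : All (IsEvenWalk m nothing v) (evenWalks G m nothing v)
      sound = evenWalks-sound m nothing v
      ∣V₁∣<#walks : ∣ V₁ part ∣ < length (evenWalks G m nothing v)
      ∣V₁∣<#walks = subst (_ <_) (≡.sym (length-evenWalks-root m pv)) ∣V₁∣<N₁′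
      ends∈V₁ : All (λ R → last⁺ v R ∈ₛ V₁ part) (evenWalks G m nothing v)
      ends∈V₁ = All.map (λ w → ∈ₛ-tabulate⁺ (cong not (≡.trans (IsEvenWalk.same-side w) pv))) sound

    ∃-V₁-vertex : 0 < s → V → ∃ λ v → part v ≡ false
    ∃-V₁-vertex 0<s u with part u in pu
    ... | false = u , pu
    ... | true  = let w , uw = ∃-neighbour G u (subst (0 <_) (≡.sym (proj₂ breg u pu)) 0<s)
                  in  w , ≡.trans (adj⇒part≡not uw) (cong not pu)

lemma2p1 : (r s m : ℕ) → 2 ≤ s → s < r → 1 ≤ m →
    {n : ℕ} (G : Graph n) (part : Fin n → Bool) →
    IsBipartition G part → Biregular G part r s →
    HasDiameter G (2 * m + 1) → n ≡ M r s m →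
    GirthLE G (4 * m)
lemma2p1 r s m 2≤s s<r _ G part bip breg (_ , u , _) n≡M =
  let _ , pv = ∃-V₁-vertex G bip breg (≤-trans (s≤s z≤n) 2≤s) u
      ∣V₁∣<N₁′ = M-order⇒n₁<N₁′ m 2≤s s<r (∣V₁∣*r≡∣V₂∣*s G bip breg) (≡.trans (∣V₁∣+∣V₂∣≡n part) n≡M)
  in  GirthLE-mono G (≤-reflexive (2m+2m≡4m m)) (∣V₁∣<N₁′⇒GirthLE G bip breg m pv ∣V₁∣<N₁′)
  where
  2m+2m≡4m : ∀ m → 2 * m + 2 * m ≡ 4 * m
  2m+2m≡4m = solve-∀
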